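{- Let $h\geq r\geq s\geq 2$ be integers, let $V=A\sqcup B$ be a finite set with $|B|\leq |A|$, and let $E=\binom{A}{r}$. Then there exists a set $E'\subseteq\binom{V}{r}$ with $|E'|\leq r h^r|A|^{s-2}|B|$ such that the $r$-graph $G=(V,E\cup E')$ is $T_{r,h,s}$-template saturated in $\binom{V}{r}$.
   Context: $\binom{X}{r}$ denotes the set of $r$-element subsets of $X$; an $r$-graph is a pair $(V,E)$ with $E\subseteq\binom{V}{r}$. For integers $s\leq r\leq h$, $T^-_{r,h,s}$ is the $r$-graph obtained from the complete $r$-graph $K^r_h$ on $h$ vertices by choosing a set $Z$ of $s$ vertices and deleting all edges containing $Z$; $T_{r,h,s}$ is obtained from $T^-_{r,h,s}$ by adding one missing edge $f$, called the special edge. $G=(V,E)$ is $T_{r,h,s}$-template saturated in $\binom{V}{r}$ if the elements of $\binom{V}{r}\setminus E$ admit an ordering $e_1,\dots,e_k$ such that for each $i$ the $r$-graph $G\cup\{e_1,\dots,e_i\}$ contains a copy (subgraph isomorphic to) $T_{r,h,s}$ in which $e_i$ plays the role of the special edge. -}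

module Defs where

open import Data.Nat using (ℕ; suc; _<_)
open import Data.Fin using (Fin; toℕ)
open import Data.Fin.Subset using (Subset; _∈_; ∣_∣)
open import Data.List using (List; length; lookup; take)
import Data.List.Membership.Propositional as LM
open import Data.List.Relation.Unary.Unique.Propositional using (Unique)
open import Data.Product using (Σ; ∃; _×_)
open import Data.Sum using (_⊎_)
open import Function.Bundles using (_⇔_)
open import Function.Definitions using (Injective)
open import Relation.Binary.PropositionalEquality using (_≡_)
open import Relation.Nullary using (¬_)

_∈ₗ_ : ∀ {n} → Subset n → List (Subset n) → Set
e ∈ₗ L = e LM.∈ L

-- an r-graph on vertex set Fin n is given by its edge predicate on subsets
-- (only r-element subsets are relevant)
RGraph : ℕ → Set₁
RGraph n = Subset n → Set

IsImage : ∀ {h n} → (Fin h → Fin n) → Subset h → Subset n → Set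
IsImage {h} φ S e = ∀ v → (v ∈ e) ⇔ (∃ λ (u : Fin h) → (u ∈ S) × (φ u ≡ v))

-- In T_{r,h,s} on vertex set Fin h we take Z = {u : toℕ u < s}.
ContainsZ : ∀ {h} → ℕ → Subset h → Set
ContainsZ {h} s S = ∀ (u : Fin h) → toℕ u < s → u ∈ S

-- H contains a copy of T_{r,h,s} in which e plays the role of the special edge:
-- an injective vertex map φ : Fin h → V, a special edge f (an r-set
-- containing Z) mapped onto e, and every edge of T^-_{r,h,s} (r-sets of
-- Fin h not containing Z) mapped onto an edge of H; also e itself is in H.
HasTemplateCopy : ∀ {n} → (r h s : ℕ) → RGraph n → Subset n → Set
HasTemplateCopy {n} r h s H e =
  Σ (Fin h → Fin n) λ φ → Injective _≡_ _≡_ φ ×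
  Σ (Subset h) λ f → (∣ f ∣ ≡ r) × ContainsZ s f × IsImage φ f e × H e ×
  (∀ (S : Subset h) → ∣ S ∣ ≡ r → ¬ ContainsZ s S →
     ∀ (e' : Subset n) → IsImage φ S e' → H e')

-- G is T_{r,h,s}-template saturated in binom(V, r): the missing r-sets can be
-- listed (without repetition, exhaustively) as e_1,…,e_k so that
-- G ∪ {e_1,…,e_i} contains a copy of T_{r,h,s} with e_i as special edge.
TemplateSaturated : ∀ {n} → (r h s : ℕ) → RGraph n → Set
TemplateSaturated {n} r h s G =
  Σ (List (Subset n)) λ L → Unique L ×
  (∀ e → (e ∈ₗ L) ⇔ ((∣ e ∣ ≡ r) × ¬ G e)) ×
  (∀ (i : Fin (length L)) →
     HasTemplateCopy r h s (λ e → G e ⊎ (e ∈ₗ take (suc (toℕ i)) L)) (lookup L i))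

-- Order the vertices with A first and call the first h of them the core K; measure an r-set by
-- the number of its vertices off K. E' consists of the r-sets inside K and the r-sets {b} ∪ X ∪ Y
-- with b ∈ B = ∁ A, ∣X∣ = s ∸ 2 and Y ⊆ K, so ∣E'∣ ≤ ∣B∣ (h^r + n^(s∸2) h^(r∸(s∸1))), which is at
-- most r h^r ∣A∣^(s∸2) ∣B∣ because n ≤ 2∣A∣ ≤ h∣A∣. Since K ⊆ A or A ⊆ K, every r-set meeting B with
-- fewer than s vertices off K lies in E', so each missing edge has at least s vertices off K.
-- Add the missing edges by increasing measure. For such an edge e, send the first r template
-- vertices onto e, off-K vertices first so that Z lands off K, and the other h ∸ r onto K ∖ e.
-- Every other template edge misses a vertex of Z, so its image has smaller measure and is present.

module Submission where

open import Defs
open import Data.Bool.Properties using () renaming (_≟_ to _≟ᵇ_)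
open import Data.Empty using (⊥-elim)
open import Data.Fin using (Fin; zero; suc; toℕ; cast)
import Data.Fin.Properties as Fin
open import Data.Fin.Properties
  using (toℕ-cast; toℕ-injective; cast-involutive; ¬∀⟶∃¬) renaming (_≟_ to _≟ᶠ_)
open import Data.Fin.Subset
  using (Subset; Nonempty; _∈_; _∉_; _⊆_; ∣_∣; ⊥; ⁅_⁆; ∁; _∪_; _∩_; _─_; _-_; inside; outside)
open import Data.Fin.Subset.Properties
  using (_∈?_; _⊆?_; nonempty?; ∉⊥; x∈⁅x⁆; x∈⁅y⁆⇒x≡y; x∈p∪q⁺; x∈p∪q⁻; x∈p∩q⁺; x∈p∩q⁻;
         x∈∁p⇒x∉p; x∉p⇒x∈∁p; x∈p∧x≢y⇒x∈p-y; ⊆-antisym; p─q⊆p; p⊂q⇒∣p∣<∣q∣;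
         Empty-unique; ∣⊥∣≡0; ∣p∣≤n; ∣∁p∣≡n∸∣p∣; ∣p∩q∣≤∣q∣)
open import Data.List
  using (List; []; _∷_; [_]; _++_; length; map; filter; take; drop; lookup; allFin;
         concatMap; cartesianProductWith; deduplicate)
open import Data.List.Membership.Propositional using (lose) renaming (_∈_ to _∈ᴸ_)
open import Data.List.Membership.Propositional.Properties
  using (∈-map⁺; ∈-map⁻; ∈-++⁺ˡ; ∈-++⁺ʳ; ∈-++⁻; ∈-filter⁺; ∈-filter⁻; ∈-concatMap⁺; ∈-allFin;
         ∈-lookup; ∈-cartesianProductWith⁺; ∈-deduplicate⁺; ∈-deduplicate⁻)
open import Data.List.Membership.Propositional.Properties.WithK using (unique∧set⇒bag)
import Data.List.Membership.DecPropositional as DecMembership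
open import Data.List.Properties
  using (length-++; length-map; length-take; length-drop; length-filter; length-tabulate;
         take-all; take++drop≡id; ++-assoc)
open import Data.List.Relation.Binary.BagAndSetEquality using (∼bag⇒↭)
open import Data.List.Relation.Binary.Permutation.Propositional.Properties using (↭-length)
open import Data.List.Relation.Unary.All as All using (All; []; _∷_)
import Data.List.Relation.Unary.All.Properties as Allₚ
open import Data.List.Relation.Unary.AllPairs using (AllPairs; []; _∷_)
import Data.List.Relation.Unary.AllPairs.Properties as AllPairs
open import Data.List.Relation.Unary.Any using (here; there)
open import Data.List.Relation.Unary.Unique.Propositional using (Unique)
import Data.List.Relation.Unary.Unique.Propositional.Properties as Unique
import Data.List.Relation.Unary.Unique.DecPropositional.Properties as DecUnique
open import Data.Nat
  using (ℕ; zero; suc; _+_; _*_; _∸_; _⊓_; _^_; _≤_; _<_; _≟_; _≤?_; _<?_; z≤n; s≤s;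
         NonZero; >-nonZero)
open import Data.Nat.Properties
  using (suc-injective; ≤-reflexive; ≤-trans; <-≤-trans; ≤-<-trans; <-irrefl; <⇒≱; ≰⇒>; ≰⇒≥;
         ≤∧≢⇒<; n≤1+n; n<1+n; +-suc; +-identityʳ; *-identityʳ; *-assoc; *-comm; ^-zeroˡ;
         ^-distribˡ-+-*; +-mono-≤; +-monoʳ-≤; *-mono-≤; *-monoʳ-≤; *-monoˡ-≤; ^-monoˡ-≤; ^-monoʳ-≤;
         ∸-monoˡ-≤; ∸-monoʳ-≤; m≤m+n; m≤n⇒m⊓n≡m; m⊓n≤m; m+n∸m≡n; m+n∸n≡m; m+[n∸m]≡n;
         module ≤-Reasoning)
open import Data.Nat.Tactic.RingSolver using (solve-∀)
open import Data.Product using (Σ; ∃; _×_; _,_; proj₁; proj₂)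
open import Data.Sum using (_⊎_; inj₁; inj₂)
open import Data.Vec using ([]; _∷_; here; there)
open import Data.Vec.Properties using (≡-dec)
open import Function using (_∘_; id)
open import Function.Bundles using (Equivalence; _⇔_; mk⇔)
open import Function.Definitions using (Injective)
open import Function.Properties.Equivalence using () renaming (trans to ⇔-trans; sym to ⇔-sym)
open import Relation.Binary.Core using (Rel)
open import Relation.Binary.Definitions using (DecidableEquality)
open import Relation.Binary.PropositionalEquality
  using (_≡_; _≢_; refl; sym; trans; cong; cong₂; subst; module ≡-Reasoning)
open import Relation.Nullary using (¬_; Dec; yes; no)
open import Relation.Nullary.Decidable using (_×-dec_; _⊎-dec_; _→-dec_; ¬?; decidable-stable)

private variable
  X Y Z : Set
  h k n : ℕ
  x : X
  xs ys : List X
  p : Subset n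

-- Arithmetic of the edge count

^-distribʳ-* : ∀ m n k → (m * n) ^ k ≡ m ^ k * n ^ k
^-distribʳ-* m n zero    = refl
^-distribʳ-* m n (suc k) = trans (cong (m * n *_) (^-distribʳ-* m n k)) (interchange m n (m ^ k) (n ^ k))
  where
  interchange : ∀ a b c d → a * b * (c * d) ≡ a * c * (b * d)
  interchange = solve-∀

suc[s∸2+[r∸[s∸1]]]≡r : ∀ r s → 2 ≤ s → s ≤ r → suc (s ∸ 2 + (r ∸ (s ∸ 1))) ≡ r
suc[s∸2+[r∸[s∸1]]]≡r r (suc (suc k)) _          s≤r = m+[n∸m]≡n (≤-trans (n≤1+n (suc k)) s≤r)
suc[s∸2+[r∸[s∸1]]]≡r r 1             (s≤s ()) _

core-term-bound : ∀ {c h a} r k → c ≤ h → 1 ≤ a → c ^ r ≤ h ^ r * a ^ k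
core-term-bound {c} {h} {a} r k c≤h 1≤a = begin
  c ^ r         ≤⟨ ^-monoˡ-≤ r c≤h ⟩
  h ^ r         ≡⟨ *-identityʳ (h ^ r) ⟨
  h ^ r * 1     ≡⟨ cong (h ^ r *_) (^-zeroˡ k) ⟨
  h ^ r * 1 ^ k ≤⟨ *-monoʳ-≤ (h ^ r) (^-monoˡ-≤ k 1≤a) ⟩
  h ^ r * a ^ k ∎
  where open ≤-Reasoning

crossing-term-bound : ∀ {N c h a} r k j .{{_ : NonZero h}} → N ≤ a * h → c ≤ h → k + j ≤ r →
  N ^ k * c ^ j ≤ h ^ r * a ^ k
crossing-term-bound {N} {c} {h} {a} r k j N≤ah c≤h k+j≤r = begin
  N ^ k * c ^ j             ≤⟨ *-mono-≤ (^-monoˡ-≤ k N≤ah) (^-monoˡ-≤ j c≤h) ⟩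
  (a * h) ^ k * h ^ j       ≡⟨ cong (_* h ^ j) (^-distribʳ-* a h k) ⟩
  a ^ k * h ^ k * h ^ j     ≡⟨ *-assoc (a ^ k) (h ^ k) (h ^ j) ⟩
  a ^ k * (h ^ k * h ^ j)   ≡⟨ cong (a ^ k *_) (^-distribˡ-+-* h k j) ⟨
  a ^ k * h ^ (k + j)       ≤⟨ *-monoʳ-≤ (a ^ k) (^-monoʳ-≤ h k+j≤r) ⟩
  a ^ k * h ^ r             ≡⟨ *-comm (a ^ k) (h ^ r) ⟩
  h ^ r * a ^ k             ∎
  where open ≤-Reasoning

edge-count-bound : ∀ {h r s a b c N} → 2 ≤ s → s ≤ r → r ≤ h → b ≤ a → c ≤ h → N ≤ a + b →
  b * (c ^ r + N ^ (s ∸ 2) * c ^ (r ∸ (s ∸ 1))) ≤ r * h ^ r * a ^ (s ∸ 2) * b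
edge-count-bound {b = zero} _ _ _ _ _ _ = z≤n
edge-count-bound {h} {r} {s} {a} {b@(suc _)} {c} {N} 2≤s s≤r r≤h b≤a c≤h N≤a+b = begin
  b * (c ^ r + N ^ (s ∸ 2) * c ^ (r ∸ (s ∸ 1))) ≤⟨ *-monoʳ-≤ b (+-mono-≤ core crossing) ⟩
  b * (M + M)                                   ≡⟨ cong (λ y → b * (M + y)) (+-identityʳ M) ⟨
  b * (2 * M)                                   ≤⟨ *-monoʳ-≤ b (*-monoˡ-≤ M (≤-trans 2≤s s≤r)) ⟩
  b * (r * M)                                   ≡⟨ reorder b r (h ^ r) (a ^ (s ∸ 2)) ⟩
  r * h ^ r * a ^ (s ∸ 2) * b                   ∎
  where
  open ≤-Reasoning
  M = h ^ r * a ^ (s ∸ 2)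
  2≤h = ≤-trans 2≤s (≤-trans s≤r r≤h)
  instance
    h≢0 : NonZero h
    h≢0 = >-nonZero (≤-trans (s≤s z≤n) 2≤h)
  reorder : ∀ x y z w → x * (y * (z * w)) ≡ y * z * w * x
  reorder = solve-∀
  core = core-term-bound r (s ∸ 2) c≤h (≤-trans (s≤s z≤n) b≤a)
  N≤ah : N ≤ a * h
  N≤ah = begin
    N       ≤⟨ N≤a+b ⟩
    a + b   ≤⟨ +-monoʳ-≤ a b≤a ⟩
    a + a   ≡⟨ cong (a +_) (+-identityʳ a) ⟨
    2 * a   ≡⟨ *-comm 2 a ⟩
    a * 2   ≤⟨ *-monoʳ-≤ a 2≤h ⟩
    a * h   ∎
  crossing = crossing-term-bound r (s ∸ 2) (r ∸ (s ∸ 1)) N≤ah c≤h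
    (≤-trans (n≤1+n _) (≤-reflexive (suc[s∸2+[r∸[s∸1]]]≡r r s 2≤s s≤r)))

length-cartesianProductWith : ∀ (f : X → Y → Z) xs ys →
  length (cartesianProductWith f xs ys) ≡ length xs * length ys
length-cartesianProductWith f []       ys = refl
length-cartesianProductWith f (x ∷ xs) ys =
  trans (length-++ (map (f x) ys)) (cong₂ _+_ (length-map (f x) ys) (length-cartesianProductWith f xs ys))

length-concatMap-const : ∀ (f : X → List Y) {m} → (∀ x → length (f x) ≡ m) → ∀ xs →
  length (concatMap f xs) ≡ length xs * m
length-concatMap-const f ∣f∣≡m []       = refl
length-concatMap-const f ∣f∣≡m (x ∷ xs) =
  trans (length-++ (f x)) (cong₂ _+_ (∣f∣≡m x) (length-concatMap-const f ∣f∣≡m xs))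

tuples : ℕ → List X → List (List X)
tuples zero    xs = [ [] ]
tuples (suc k) xs = cartesianProductWith _∷_ xs (tuples k xs)

length-tuples : ∀ k (xs : List X) → length (tuples k xs) ≡ length xs ^ k
length-tuples zero    xs = refl
length-tuples (suc k) xs =
  trans (length-cartesianProductWith _∷_ xs (tuples k xs)) (cong (length xs *_) (length-tuples k xs))

∈-tuples : ∀ (ys : List X) → All (_∈ᴸ xs) ys → ys ∈ᴸ tuples (length ys) xs
∈-tuples []       []           = here refl
∈-tuples (y ∷ ys) (y∈ ∷ ys⊆) = ∈-cartesianProductWith⁺ _∷_ y∈ (∈-tuples ys ys⊆)

∈-take⁻ : ∀ k (xs : List X) → x ∈ᴸ take k xs → x ∈ᴸ xs
∈-take⁻ (suc k) (y ∷ xs) (here x≡y) = here x≡y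
∈-take⁻ (suc k) (y ∷ xs) (there x∈) = there (∈-take⁻ k xs x∈)

∈-take-++⁻ˡ : ∀ k (xs : List X) {ys} → k ≤ length xs → x ∈ᴸ take k (xs ++ ys) → x ∈ᴸ xs
∈-take-++⁻ˡ (suc k) (y ∷ xs) k≤     (here x≡y) = here x≡y
∈-take-++⁻ˡ (suc k) (y ∷ xs) (s≤s k≤) (there x∈) = there (∈-take-++⁻ˡ k xs k≤ x∈)

∈-take-++⁺ˡ : ∀ k (xs : List X) {ys} → length xs ≤ k → x ∈ᴸ xs → x ∈ᴸ take k (xs ++ ys)
∈-take-++⁺ˡ (suc k) (y ∷ xs) ≤k       (here x≡y) = here x≡y
∈-take-++⁺ˡ (suc k) (y ∷ xs) (s≤s ≤k) (there x∈) = there (∈-take-++⁺ˡ k xs ≤k x∈)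

All-drop-++ : ∀ {P : X → Set} k xs {ys} → length xs ≤ k → All P ys → All P (drop k (xs ++ ys))
All-drop-++ k       []       _        ys⊆ = Allₚ.drop⁺ k ys⊆
All-drop-++ (suc k) (x ∷ xs) (s≤s ≤k) ys⊆ = All-drop-++ k xs ≤k ys⊆

lookup∈take : ∀ (xs : List X) (i : Fin (length xs)) → toℕ i < k → lookup xs i ∈ᴸ take k xs
lookup∈take (x ∷ xs) zero    (s≤s _) = here refl
lookup∈take (x ∷ xs) (suc i) (s≤s i<k) = there (lookup∈take xs i i<k)

∈-take⇒lookup : ∀ k (xs : List X) → x ∈ᴸ take k xs → Σ (Fin (length xs)) λ i → toℕ i < k × lookup xs i ≡ x
∈-take⇒lookup (suc k) (y ∷ xs) (here refl) = zero , s≤s z≤n , refl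
∈-take⇒lookup (suc k) (y ∷ xs) (there x∈) with i , i<k , refl ← ∈-take⇒lookup k xs x∈ = suc i , s≤s i<k , refl

lookup-injective : ∀ {xs : List X} → Unique xs → ∀ i j → lookup xs i ≡ lookup xs j → i ≡ j
lookup-injective {xs = x ∷ xs} _          zero    zero    _  = refl
lookup-injective {xs = x ∷ xs} (x∉ ∷ _)   zero    (suc j) eq = ⊥-elim (All.lookup x∉ (∈-lookup j) eq)
lookup-injective {xs = x ∷ xs} (x∉ ∷ _)   (suc i) zero    eq = ⊥-elim (All.lookup x∉ (∈-lookup i) (sym eq))
lookup-injective {xs = x ∷ xs} (_ ∷ xs!)  (suc i) (suc j) eq = cong suc (lookup-injective xs! i j eq)

AllPairs-∈-take-lookup : ∀ {ℓ} {R : Rel X ℓ} {xs : List X} {y} → AllPairs R xs → (i : Fin (length xs)) →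
  y ∈ᴸ xs → ¬ R (lookup xs i) y → y ∈ᴸ take (suc (toℕ i)) xs
AllPairs-∈-take-lookup _             _       (here refl) _  = here refl
AllPairs-∈-take-lookup (Rx ∷ _)      zero    (there y∈) ¬R = ⊥-elim (¬R (All.lookup Rx y∈))
AllPairs-∈-take-lookup (_ ∷ sorted) (suc i) (there y∈) ¬R = there (AllPairs-∈-take-lookup sorted i y∈ ¬R)

take-drop-∈-tuples : ∀ k j (xs ys : List X) {as bs : List X} → length xs ≤ k → length (xs ++ ys) ≡ k + j →
  All (_∈ᴸ as) (xs ++ ys) → All (_∈ᴸ bs) ys → take k (xs ++ ys) ∈ᴸ tuples k as × drop k (xs ++ ys) ∈ᴸ tuples j bs
take-drop-∈-tuples k j xs ys ∣xs∣≤k ∣xs++ys∣≡k+j xs++ys⊆as ys⊆bs =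
  subst (λ m → take k (xs ++ ys) ∈ᴸ tuples m _) ∣take∣≡k (∈-tuples _ (Allₚ.take⁺ k xs++ys⊆as)) ,
  subst (λ m → drop k (xs ++ ys) ∈ᴸ tuples m _) ∣drop∣≡j (∈-tuples _ (All-drop-++ k xs ∣xs∣≤k ys⊆bs))
  where
  ∣take∣≡k : length (take k (xs ++ ys)) ≡ k
  ∣take∣≡k = trans (length-take k (xs ++ ys)) (trans (cong (k ⊓_) ∣xs++ys∣≡k+j) (m≤n⇒m⊓n≡m (m≤m+n k j)))
  ∣drop∣≡j : length (drop k (xs ++ ys)) ≡ j
  ∣drop∣≡j = trans (length-drop k (xs ++ ys)) (trans (cong (_∸ k) ∣xs++ys∣≡k+j) (m+n∸m≡n k j))

-- Listing by increasing measure

module _ {X : Set} (μ : X → ℕ) (xs : List X) where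

  level : ℕ → List X
  level t = filter (λ x → μ x ≟ t) xs

  levelsFrom : ℕ → ℕ → List X
  levelsFrom t zero    = []
  levelsFrom t (suc m) = level t ++ levelsFrom (suc t) m

  ∈-level⁻ : ∀ {t x} → x ∈ᴸ level t → x ∈ᴸ xs × μ x ≡ t
  ∈-level⁻ = ∈-filter⁻ (λ x → μ x ≟ _)

  ∈-levelsFrom⁻ : ∀ t m {x} → x ∈ᴸ levelsFrom t m → x ∈ᴸ xs × t ≤ μ x
  ∈-levelsFrom⁻ t (suc m) x∈ with ∈-++⁻ (level t) x∈
  ... | inj₁ x∈level = let x∈xs , μx≡t = ∈-level⁻ x∈level in x∈xs , ≤-reflexive (sym μx≡t)
  ... | inj₂ x∈rest  = let x∈xs , t<μx = ∈-levelsFrom⁻ (suc t) m x∈rest in x∈xs , ≤-trans (n≤1+n t) t<μx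

  ∈-levelsFrom⁺ : ∀ t m {x} → x ∈ᴸ xs → t ≤ μ x → μ x < t + m → x ∈ᴸ levelsFrom t m
  ∈-levelsFrom⁺ t zero    {x} x∈xs t≤μx μx<t = ⊥-elim (<⇒≱ μx<t (subst (_≤ μ x) (sym (+-identityʳ t)) t≤μx))
  ∈-levelsFrom⁺ t (suc m) {x} x∈xs t≤μx μx<  with μ x ≟ t
  ... | yes μx≡t = ∈-++⁺ˡ (∈-filter⁺ (λ x → μ x ≟ t) x∈xs μx≡t)
  ... | no  μx≢t = ∈-++⁺ʳ (level t)
        (∈-levelsFrom⁺ (suc t) m x∈xs (≤∧≢⇒< t≤μx (μx≢t ∘ sym)) (subst (μ x <_) (+-suc t m) μx<))

  levelsFrom-unique : Unique xs → ∀ t m → Unique (levelsFrom t m)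
  levelsFrom-unique xs! t zero    = []
  levelsFrom-unique xs! t (suc m) =
    Unique.++⁺ (Unique.filter⁺ (λ x → μ x ≟ t) xs!) (levelsFrom-unique xs! (suc t) m) disjoint
    where
    disjoint : ∀ {x} → ¬ (x ∈ᴸ level t × x ∈ᴸ levelsFrom (suc t) m)
    disjoint (x∈level , x∈rest) =
      <⇒≱ (proj₂ (∈-levelsFrom⁻ (suc t) m x∈rest)) (≤-reflexive (proj₂ (∈-level⁻ x∈level)))

  levelsFrom-sorted : ∀ t m → AllPairs (λ x y → μ x ≤ μ y) (levelsFrom t m)
  levelsFrom-sorted t zero    = []
  levelsFrom-sorted t (suc m) = AllPairs.++⁺ (level-sorted (level t) (All.tabulate (proj₂ ∘ ∈-level⁻)))
    (levelsFrom-sorted (suc t) m)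
    (All.tabulate λ x∈level → All.tabulate λ y∈rest →
      ≤-trans (≤-reflexive (proj₂ (∈-level⁻ x∈level))) (≤-trans (n≤1+n t) (proj₂ (∈-levelsFrom⁻ (suc t) m y∈rest))))
    where
    level-sorted : ∀ ys → All (λ y → μ y ≡ t) ys → AllPairs (λ x y → μ x ≤ μ y) ys
    level-sorted []       []             = []
    level-sorted (y ∷ ys) (μy≡t ∷ μys≡t) =
      All.map (λ μz≡t → ≤-reflexive (trans μy≡t (sym μz≡t))) μys≡t ∷ level-sorted ys μys≡t

-- Finite sets as lists

elements : Subset n → List (Fin n)
elements []            = []
elements (inside ∷ p)  = zero ∷ map suc (elements p)
elements (outside ∷ p) = map suc (elements p)

∈-elements⁺ : x ∈ p → x ∈ᴸ elements p
∈-elements⁺ {p = inside ∷ p}  here       = here refl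
∈-elements⁺ {p = inside ∷ p}  (there x∈p) = there (∈-map⁺ suc (∈-elements⁺ x∈p))
∈-elements⁺ {p = outside ∷ p} (there x∈p) = ∈-map⁺ suc (∈-elements⁺ x∈p)

∈-elements⁻ : x ∈ᴸ elements p → x ∈ p
∈-elements⁻ {p = inside ∷ p}  (here refl) = here
∈-elements⁻ {p = inside ∷ p}  (there x∈) with _ , y∈ , refl ← ∈-map⁻ suc x∈ = there (∈-elements⁻ y∈)
∈-elements⁻ {p = outside ∷ p} x∈ with _ , y∈ , refl ← ∈-map⁻ suc x∈ = there (∈-elements⁻ y∈)

∈-elements : x ∈ᴸ elements p ⇔ x ∈ p
∈-elements = mk⇔ ∈-elements⁻ ∈-elements⁺

elements-unique : ∀ (p : Subset n) → Unique (elements p)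
elements-unique []            = []
elements-unique (inside ∷ p)  =
  Allₚ.map⁺ (All.universal (λ _ ()) _) ∷ Unique.map⁺ Fin.suc-injective (elements-unique p)
elements-unique (outside ∷ p) = Unique.map⁺ Fin.suc-injective (elements-unique p)

length-elements : ∀ (p : Subset n) → length (elements p) ≡ ∣ p ∣
length-elements []            = refl
length-elements (inside ∷ p)  = cong suc (trans (length-map suc (elements p)) (length-elements p))
length-elements (outside ∷ p) = trans (length-map suc (elements p)) (length-elements p)

unique-length≡∣∣ : ∀ {xs : List (Fin n)} → Unique xs → (∀ {x} → x ∈ᴸ xs ⇔ x ∈ p) → length xs ≡ ∣ p ∣
unique-length≡∣∣ {p = p} xs! xs≈p = trans (↭-length xs↭elements) (length-elements p)
  where xs↭elements = ∼bag⇒↭ (unique∧set⇒bag xs! (elements-unique p) (⇔-trans xs≈p (⇔-sym ∈-elements)))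

fromList : List (Fin n) → Subset n
fromList []       = ⊥
fromList (x ∷ xs) = ⁅ x ⁆ ∪ fromList xs

∈-fromList⁺ : ∀ {xs : List (Fin n)} → x ∈ᴸ xs → x ∈ fromList xs
∈-fromList⁺ {x = x} (here refl) = x∈p∪q⁺ (inj₁ (x∈⁅x⁆ x))
∈-fromList⁺ (there x∈xs)        = x∈p∪q⁺ (inj₂ (∈-fromList⁺ x∈xs))

∈-fromList⁻ : ∀ (xs : List (Fin n)) → x ∈ fromList xs → x ∈ᴸ xs
∈-fromList⁻ []       x∈ = ⊥-elim (∉⊥ x∈)
∈-fromList⁻ (y ∷ xs) x∈ with x∈p∪q⁻ ⁅ y ⁆ (fromList xs) x∈
... | inj₁ x∈⁅y⁆ = here (x∈⁅y⁆⇒x≡y y x∈⁅y⁆)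
... | inj₂ x∈xs  = there (∈-fromList⁻ xs x∈xs)

fromList-≡ : ∀ {xs : List (Fin n)} → (∀ {x} → x ∈ᴸ xs ⇔ x ∈ p) → fromList xs ≡ p
fromList-≡ {xs = xs} xs≈p =
  ⊆-antisym (λ x∈ → Equivalence.to xs≈p (∈-fromList⁻ xs x∈)) (λ x∈p → ∈-fromList⁺ (Equivalence.from xs≈p x∈p))

allSubsets : ∀ n → List (Subset n)
allSubsets zero    = [ [] ]
allSubsets (suc n) = cartesianProductWith _∷_ (inside ∷ outside ∷ []) (allSubsets n)

∈-allSubsets : ∀ (p : Subset n) → p ∈ᴸ allSubsets n
∈-allSubsets []            = here refl
∈-allSubsets (inside ∷ p)  = ∈-cartesianProductWith⁺ _∷_ {xs = inside ∷ outside ∷ []} (here refl)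
                               (∈-allSubsets p)
∈-allSubsets (outside ∷ p) = ∈-cartesianProductWith⁺ _∷_ {xs = inside ∷ outside ∷ []} (there (here refl))
                               (∈-allSubsets p)

_≟ˢ_ : DecidableEquality (Subset n)
_≟ˢ_ = ≡-dec _≟ᵇ_

x∈p─q⇒x∉q : ∀ {p q : Subset n} → x ∈ p ─ q → x ∉ q
x∈p─q⇒x∉q {p = inside ∷ p} {outside ∷ q} here ()
x∈p─q⇒x∉q {p = _ ∷ p}      {_ ∷ q}       (there x∈) (there x∈q) = x∈p─q⇒x∉q x∈ x∈q

⊈⇒∃ : ∀ {p q : Subset n} → ¬ p ⊆ q → ∃ λ x → x ∈ p × x ∉ q
⊈⇒∃ {p = p} {q} p⊈q with nonempty? (p ∩ ∁ q)
... | yes (x , x∈) = x , proj₁ (x∈p∩q⁻ p (∁ q) x∈) , x∈∁p⇒x∉p (proj₂ (x∈p∩q⁻ p (∁ q) x∈))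
... | no  empty    = ⊥-elim (p⊈q λ {x} x∈p →
  decidable-stable (x ∈? q) (λ x∉q → empty (x , x∈p∩q⁺ (x∈p , x∉p⇒x∈∁p x∉q))))

∣p-x∩q∣<∣p∩q∣ : ∀ (p q : Subset n) → x ∈ p ∩ q → ∣ (p - x) ∩ q ∣ < ∣ p ∩ q ∣
∣p-x∩q∣<∣p∩q∣ {x = x} p q x∈p∩q = p⊂q⇒∣p∣<∣q∣ (shrink , x , x∈p∩q , x∉)
  where
  shrink : (p - x) ∩ q ⊆ p ∩ q
  shrink y∈ = let y∈p-x , y∈q = x∈p∩q⁻ (p - x) q y∈ in x∈p∩q⁺ (p─q⊆p p ⁅ x ⁆ y∈p-x , y∈q)
  x∉ : x ∉ (p - x) ∩ q
  x∉ x∈ = x∈p─q⇒x∉q (proj₁ (x∈p∩q⁻ (p - x) q x∈)) (x∈⁅x⁆ x)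

module _ (p q : Subset n) where

  splitList : List (Fin n)
  splitList = elements (p ∩ ∁ q) ++ elements (p ∩ q)

  ∈-splitList : x ∈ᴸ splitList ⇔ x ∈ p
  ∈-splitList {x} = mk⇔ to from
    where
    to : x ∈ᴸ splitList → x ∈ p
    to x∈ with ∈-++⁻ (elements (p ∩ ∁ q)) x∈
    ... | inj₁ x∈out = proj₁ (x∈p∩q⁻ p (∁ q) (∈-elements⁻ x∈out))
    ... | inj₂ x∈in  = proj₁ (x∈p∩q⁻ p q (∈-elements⁻ x∈in))
    from : x ∈ p → x ∈ᴸ splitList
    from x∈p with x ∈? q
    ... | yes x∈q = ∈-++⁺ʳ (elements (p ∩ ∁ q)) (∈-elements⁺ (x∈p∩q⁺ (x∈p , x∈q)))
    ... | no  x∉q = ∈-++⁺ˡ (∈-elements⁺ (x∈p∩q⁺ (x∈p , x∉p⇒x∈∁p x∉q)))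

  splitList-unique : Unique splitList
  splitList-unique = Unique.++⁺ (elements-unique (p ∩ ∁ q)) (elements-unique (p ∩ q)) λ (x∈out , x∈in) →
    x∈∁p⇒x∉p (proj₂ (x∈p∩q⁻ p (∁ q) (∈-elements⁻ x∈out))) (proj₂ (x∈p∩q⁻ p q (∈-elements⁻ x∈in)))

  ∣p∩∁q∣+∣p∩q∣≡∣p∣ : ∣ p ∩ ∁ q ∣ + ∣ p ∩ q ∣ ≡ ∣ p ∣
  ∣p∩∁q∣+∣p∩q∣≡∣p∣ = begin
    ∣ p ∩ ∁ q ∣ + ∣ p ∩ q ∣
      ≡⟨ cong₂ _+_ (length-elements (p ∩ ∁ q)) (length-elements (p ∩ q)) ⟨
    length (elements (p ∩ ∁ q)) + length (elements (p ∩ q))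
      ≡⟨ length-++ (elements (p ∩ ∁ q)) ⟨
    length splitList
      ≡⟨ unique-length≡∣∣ splitList-unique ∈-splitList ⟩
    ∣ p ∣ ∎
    where open ≡-Reasoning

module _ (p q : Subset n) {b : Fin n} (b∈p : b ∈ p) where

  ∈-∷-splitList-remove : x ∈ᴸ b ∷ splitList (p - b) q ⇔ x ∈ p
  ∈-∷-splitList-remove {x} = mk⇔ to from
    where
    to : x ∈ᴸ b ∷ splitList (p - b) q → x ∈ p
    to (here refl) = b∈p
    to (there x∈)  = p─q⊆p p ⁅ b ⁆ (Equivalence.to (∈-splitList (p - b) q) x∈)
    from : x ∈ p → x ∈ᴸ b ∷ splitList (p - b) q
    from x∈p with x ≟ᶠ b
    ... | yes refl = here refl
    ... | no  x≢b  = there (Equivalence.from (∈-splitList (p - b) q) (x∈p∧x≢y⇒x∈p-y x∈p x≢b))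

  ∷-splitList-remove-unique : Unique (b ∷ splitList (p - b) q)
  ∷-splitList-remove-unique = All.tabulate b∉ ∷ splitList-unique (p - b) q
    where
    b∉ : ∀ {x} → x ∈ᴸ splitList (p - b) q → b ≢ x
    b∉ x∈ refl = x∈p─q⇒x∉q (Equivalence.to (∈-splitList (p - b) q) x∈) (x∈⁅x⁆ b)

∣p∣>0⇒nonempty : ∀ {p : Subset n} → 0 < ∣ p ∣ → Nonempty p
∣p∣>0⇒nonempty {n} {p} 0<∣p∣ with nonempty? p
... | yes p≢∅ = p≢∅
... | no  p≡∅ = ⊥-elim (<-irrefl (sym (trans (cong ∣_∣ (Empty-unique p≡∅)) (∣⊥∣≡0 n))) 0<∣p∣)

-- Template copies

image-card : ∀ {φ : Fin h → Fin n} {S e} → Injective _≡_ _≡_ φ → IsImage φ S e → ∣ e ∣ ≡ ∣ S ∣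
image-card {φ = φ} {S} {e} φ-inj S↦e =
  trans (sym (unique-length≡∣∣ (Unique.map⁺ φ-inj (elements-unique S)) image))
        (trans (length-map φ (elements S)) (length-elements S))
  where
  image : ∀ {x} → x ∈ᴸ map φ (elements S) ⇔ x ∈ e
  image {x} = mk⇔
    (λ x∈ → let u , u∈ , x≡φu = ∈-map⁻ φ x∈ in Equivalence.from (S↦e x) (u , ∈-elements⁻ u∈ , sym x≡φu))
    (λ x∈e → let u , u∈S , φu≡x = Equivalence.to (S↦e x) x∈e in subst (_∈ᴸ _) φu≡x (∈-map⁺ φ (∈-elements⁺ u∈S)))

initial : ℕ → Subset h
initial         zero    = ⊥
initial {zero}  (suc r) = []
initial {suc h} (suc r) = inside ∷ initial r

∈-initial⁺ : ∀ {r} {u : Fin h} → toℕ u < r → u ∈ initial r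
∈-initial⁺ {r = suc r} {zero}  _         = here
∈-initial⁺ {r = suc r} {suc u} (s≤s u<r) = there (∈-initial⁺ u<r)

∈-initial⁻ : ∀ r {u : Fin h} → u ∈ initial r → toℕ u < r
∈-initial⁻ zero    {u}     u∈ = ⊥-elim (∉⊥ u∈)
∈-initial⁻ (suc r) {zero}  _          = s≤s z≤n
∈-initial⁻ (suc r) {suc u} (there u∈) = s≤s (∈-initial⁻ r u∈)

module Enumeration (xs : List X) (xs! : Unique xs) {h} (∣xs∣≡h : length xs ≡ h) where

  index : Fin h → Fin (length xs)
  index = cast (sym ∣xs∣≡h)

  enum : Fin h → X
  enum u = lookup xs (index u)

  enum-injective : Injective _≡_ _≡_ enum
  enum-injective {u} {v} eq = toℕ-injective (begin
    toℕ u           ≡⟨ toℕ-cast _ u ⟨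
    toℕ (index u)   ≡⟨ cong toℕ (lookup-injective xs! (index u) (index v) eq) ⟩
    toℕ (index v)   ≡⟨ toℕ-cast _ v ⟩
    toℕ v           ∎)
    where open ≡-Reasoning

  enum∈ : ∀ u → enum u ∈ᴸ xs
  enum∈ u = ∈-lookup (index u)

  enum∈take : ∀ {k} u → toℕ u < k → enum u ∈ᴸ take k xs
  enum∈take u u<k = lookup∈take xs (index u) (subst (_< _) (sym (toℕ-cast _ u)) u<k)

  ∈take⇒enum : ∀ k {x} → x ∈ᴸ take k xs → ∃ λ u → toℕ u < k × enum u ≡ x
  ∈take⇒enum k x∈ with i , i<k , refl ← ∈-take⇒lookup k xs x∈ =
    cast ∣xs∣≡h i , subst (_< k) (sym (toℕ-cast ∣xs∣≡h i)) i<k ,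
    cong (lookup xs) (cast-involutive (sym ∣xs∣≡h) ∣xs∣≡h i)

offCore : Subset n → Subset n → ℕ
offCore K e = ∣ e ∩ ∁ K ∣

¬ContainsZ⇒∃ : ∀ {h} s {S : Subset h} → ¬ ContainsZ s S → ∃ λ z → toℕ z < s × z ∉ S
¬ContainsZ⇒∃ {h} s {S} ¬Z with z , ¬[z<s⇒z∈S] ← ¬∀⟶∃¬ h _ (λ u → (toℕ u <? s) →-dec (u ∈? S)) ¬Z
  with toℕ z <? s
... | yes z<s = z , z<s , λ z∈S → ¬[z<s⇒z∈S] λ _ → z∈S
... | no  z≮s = ⊥-elim (¬[z<s⇒z∈S] λ z<s → ⊥-elim (z≮s z<s))

-- The first r template vertices go to e, listed with e ∖ K first; the other h ∸ r go to K ∖ e.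
module PaddedEnumeration {r h} (r≤h : r ≤ h) {K e : Subset n} (∣K∣≡h : ∣ K ∣ ≡ h) (∣e∣≡r : ∣ e ∣ ≡ r) where

  padding : List (Fin n)
  padding = take (h ∸ r) (elements (K ∩ ∁ e))

  listing : List (Fin n)
  listing = splitList e K ++ padding

  length-splitList : length (splitList e K) ≡ r
  length-splitList = trans (unique-length≡∣∣ (splitList-unique e K) (∈-splitList e K)) ∣e∣≡r

  length-padding : length padding ≡ h ∸ r
  length-padding = trans (length-take (h ∸ r) _) (m≤n⇒m⊓n≡m (begin
    h ∸ r                               ≤⟨ ∸-monoʳ-≤ h (≤-trans (∣p∩q∣≤∣q∣ K e) (≤-reflexive ∣e∣≡r)) ⟩
    h ∸ ∣ K ∩ e ∣                       ≡⟨ cong (_∸ ∣ K ∩ e ∣) (trans (∣p∩∁q∣+∣p∩q∣≡∣p∣ K e) ∣K∣≡h) ⟨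
    ∣ K ∩ ∁ e ∣ + ∣ K ∩ e ∣ ∸ ∣ K ∩ e ∣   ≡⟨ m+n∸n≡m ∣ K ∩ ∁ e ∣ ∣ K ∩ e ∣ ⟩
    ∣ K ∩ ∁ e ∣                         ≡⟨ length-elements (K ∩ ∁ e) ⟨
    length (elements (K ∩ ∁ e))         ∎))
    where open ≤-Reasoning

  length-listing : length listing ≡ h
  length-listing = trans (length-++ (splitList e K))
    (trans (cong₂ _+_ length-splitList length-padding) (m+[n∸m]≡n r≤h))

  ∈padding⇒∈K∖e : x ∈ᴸ padding → x ∈ K × x ∉ e
  ∈padding⇒∈K∖e x∈ = let x∈K , x∈∁e = x∈p∩q⁻ K (∁ e) (∈-elements⁻ (∈-take⁻ (h ∸ r) _ x∈)) in x∈K , x∈∁p⇒x∉p x∈∁e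

  listing-unique : Unique listing
  listing-unique = Unique.++⁺ (splitList-unique e K) (Unique.take⁺ (h ∸ r) (elements-unique (K ∩ ∁ e)))
    λ (x∈e , x∈pad) → proj₂ (∈padding⇒∈K∖e x∈pad) (Equivalence.to (∈-splitList e K) x∈e)

  ∈listing∖K⇒∈e : x ∈ᴸ listing → x ∉ K → x ∈ e
  ∈listing∖K⇒∈e x∈ x∉K with ∈-++⁻ (splitList e K) x∈
  ... | inj₁ x∈e   = Equivalence.to (∈-splitList e K) x∈e
  ... | inj₂ x∈pad = ⊥-elim (x∉K (proj₁ (∈padding⇒∈K∖e x∈pad)))

  open Enumeration listing listing-unique length-listing public

  ∈take-r⇔∈e : x ∈ᴸ take r listing ⇔ x ∈ e
  ∈take-r⇔∈e = mk⇔
    (λ x∈ → Equivalence.to (∈-splitList e K) (∈-take-++⁻ˡ r (splitList e K) (≤-reflexive (sym length-splitList)) x∈))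
    (λ x∈e → ∈-take-++⁺ˡ r (splitList e K) (≤-reflexive length-splitList) (Equivalence.from (∈-splitList e K) x∈e))

  initial↦e : IsImage enum (initial r) e
  initial↦e v = mk⇔
    (λ v∈e → let u , u<r , enum-u≡v = ∈take⇒enum r (Equivalence.from ∈take-r⇔∈e v∈e) in u , ∈-initial⁺ u<r , enum-u≡v)
    (λ where (u , u∈ , refl) → Equivalence.to ∈take-r⇔∈e (enum∈take u (∈-initial⁻ r u∈)))

  ∣initial∣≡r : ∣ initial r ∣ ≡ r
  ∣initial∣≡r = trans (sym (image-card enum-injective initial↦e)) ∣e∣≡r

  enum<offCore⇒∈e∖K : ∀ z → toℕ z < offCore K e → enum z ∈ e ∩ ∁ K
  enum<offCore⇒∈e∖K z z< = ∈-elements⁻ (∈-take-++⁻ˡ (offCore K e) (elements (e ∩ ∁ K)) offCore≤ enum-z∈)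
    where
    offCore≤ = ≤-reflexive (sym (length-elements (e ∩ ∁ K)))
    enum-z∈ = subst (λ l → enum z ∈ᴸ take (offCore K e) l) (++-assoc (elements (e ∩ ∁ K)) _ padding) (enum∈take z z<)

template-copy : ∀ {r h s} {K e : Subset n} {H : RGraph n} → s ≤ r → r ≤ h → ∣ K ∣ ≡ h → ∣ e ∣ ≡ r →
  s ≤ offCore K e → H e → (∀ {e'} → ∣ e' ∣ ≡ r → offCore K e' < offCore K e → H e') →
  HasTemplateCopy r h s H e
template-copy {r = r} {h} {s} {K} {e} {H} s≤r r≤h ∣K∣≡h ∣e∣≡r s≤offCore He smaller⇒H =
  enum , enum-injective , initial r , ∣initial∣≡r , (λ u u<s → ∈-initial⁺ (<-≤-trans u<s s≤r)) , initial↦e ,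
  He , T⁻-edges
  where
  open PaddedEnumeration r≤h {K} {e} ∣K∣≡h ∣e∣≡r

  -- An edge of T⁻ misses some z ∈ Z, and enum z ∈ e ∖ K; so it has fewer vertices off K than e.
  T⁻-edges : ∀ S → ∣ S ∣ ≡ r → ¬ ContainsZ s S → ∀ e' → IsImage enum S e' → H e'
  T⁻-edges S ∣S∣≡r ¬Z e' S↦e' with z , z<s , z∉S ← ¬ContainsZ⇒∃ s ¬Z =
    smaller⇒H (trans (image-card enum-injective S↦e') ∣S∣≡r)
              (p⊂q⇒∣p∣<∣q∣ (e'∖K⊆e∖K , enum z , enum-z∈e∖K , enum-z∉e'∖K))
    where
    enum-z∈e∖K = enum<offCore⇒∈e∖K z (<-≤-trans z<s s≤offCore)

    enum-z∉e'∖K : enum z ∉ e' ∩ ∁ K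
    enum-z∉e'∖K x∈ with u , u∈S , enum-u≡enum-z ← Equivalence.to (S↦e' (enum z)) (proj₁ (x∈p∩q⁻ e' (∁ K) x∈)) =
      z∉S (subst (_∈ S) (enum-injective enum-u≡enum-z) u∈S)

    e'∖K⊆e∖K : e' ∩ ∁ K ⊆ e ∩ ∁ K
    e'∖K⊆e∖K {x} x∈ with x∈e' , x∈∁K ← x∈p∩q⁻ e' (∁ K) x∈
      with u , _ , refl ← Equivalence.to (S↦e' x) x∈e' =
        x∈p∩q⁺ (∈listing∖K⇒∈e (enum∈ u) (x∈∁p⇒x∉p x∈∁K) , x∈∁K)

module VertexCore {n} (h : ℕ) (A : Subset n) where

  vertexOrder : List (Fin n)
  vertexOrder = elements A ++ elements (∁ A)

  core : List (Fin n)
  core = take h vertexOrder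

  Core : Subset n
  Core = fromList core

  ∈-vertexOrder : ∀ x → x ∈ᴸ vertexOrder
  ∈-vertexOrder x with x ∈? A
  ... | yes x∈A = ∈-++⁺ˡ (∈-elements⁺ x∈A)
  ... | no  x∉A = ∈-++⁺ʳ (elements A) (∈-elements⁺ (x∉p⇒x∈∁p x∉A))

  core-unique : Unique core
  core-unique = Unique.take⁺ h (Unique.++⁺ (elements-unique A) (elements-unique (∁ A))
    λ (x∈A , x∈∁A) → x∈∁p⇒x∉p (∈-elements⁻ {p = ∁ A} x∈∁A) (∈-elements⁻ x∈A))

  ∣Core∣≡length-core : ∣ Core ∣ ≡ length core
  ∣Core∣≡length-core = sym (unique-length≡∣∣ core-unique (mk⇔ ∈-fromList⁺ (∈-fromList⁻ core)))

  Core⊆A⊎A⊆Core : Core ⊆ A ⊎ A ⊆ Core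
  Core⊆A⊎A⊆Core with h ≤? length (elements A)
  ... | yes h≤∣A∣ = inj₁ λ x∈ → ∈-elements⁻ (∈-take-++⁻ˡ h (elements A) h≤∣A∣ (∈-fromList⁻ core x∈))
  ... | no  h≰∣A∣ = inj₂ λ x∈A → ∈-fromList⁺ (∈-take-++⁺ˡ h (elements A) (≰⇒≥ h≰∣A∣) (∈-elements⁺ x∈A))

  ∉Core⇒∣Core∣≡h : ∀ {x} → x ∉ Core → ∣ Core ∣ ≡ h
  ∉Core⇒∣Core∣≡h {x} x∉Core with h ≤? length vertexOrder
  ... | yes h≤n = trans ∣Core∣≡length-core (trans (length-take h vertexOrder) (m≤n⇒m⊓n≡m h≤n))
  ... | no  h≰n =
    ⊥-elim (x∉Core (∈-fromList⁺ (subst (x ∈ᴸ_) (sym (take-all h vertexOrder (≰⇒≥ h≰n))) (∈-vertexOrder x))))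

  length-core≤h : length core ≤ h
  length-core≤h = ≤-trans (≤-reflexive (length-take h vertexOrder)) (m⊓n≤m h _)

module Saturation {r h s : ℕ} (2≤s : 2 ≤ s) (s≤r : s ≤ r) (r≤h : r ≤ h) {n} (A : Subset n) where

  open VertexCore h A

  coreEdges : List (Subset n)
  coreEdges = map fromList (tuples r core)

  crossingEdges : Fin n → List (Subset n)
  crossingEdges b = cartesianProductWith (λ xs ys → fromList (b ∷ xs ++ ys))
    (tuples (s ∸ 2) (allFin n)) (tuples (r ∸ (s ∸ 1)) core)

  -- The core edges are repeated for every b ∉ A, so that the count carries the factor ∣ ∁ A ∣.
  candidates : List (Subset n)
  candidates = concatMap (λ b → coreEdges ++ crossingEdges b) (elements (∁ A))

  E' : List (Subset n)
  E' = filter (λ e → ∣ e ∣ ≟ r) candidates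

  ∈-coreEdges : ∀ {e} → ∣ e ∣ ≡ r → e ⊆ Core → e ∈ᴸ coreEdges
  ∈-coreEdges {e} ∣e∣≡r e⊆Core =
    subst (_∈ᴸ coreEdges) (fromList-≡ ∈-elements) (∈-map⁺ fromList elements∈tuples)
    where
    elements∈tuples : elements e ∈ᴸ tuples r core
    elements∈tuples = subst (λ k → elements e ∈ᴸ tuples k core) (trans (length-elements e) ∣e∣≡r)
      (∈-tuples (elements e) (All.tabulate λ x∈ → ∈-fromList⁻ core (e⊆Core (∈-elements⁻ x∈))))

  ∈-crossingEdges : ∀ {e b} → ∣ e ∣ ≡ r → b ∈ e → b ∉ Core → offCore Core e < s → e ∈ᴸ crossingEdges b
  ∈-crossingEdges {e} {b} ∣e∣≡r b∈e b∉Core offCore<s =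
    subst (_∈ᴸ crossingEdges b) listing≡e
      (∈-cartesianProductWith⁺ (λ xs ys → fromList (b ∷ xs ++ ys)) (proj₁ pieces) (proj₂ pieces))
    where
    off on : List (Fin n)
    off = elements ((e - b) ∩ ∁ Core)
    on  = elements ((e - b) ∩ Core)

    length-rest : length (off ++ on) ≡ s ∸ 2 + (r ∸ (s ∸ 1))
    length-rest = suc-injective (begin
      suc (length (off ++ on))    ≡⟨ unique-length≡∣∣ (∷-splitList-remove-unique e Core b∈e)
                                                      (∈-∷-splitList-remove e Core b∈e) ⟩
      ∣ e ∣                       ≡⟨ ∣e∣≡r ⟩
      r                           ≡⟨ suc[s∸2+[r∸[s∸1]]]≡r r s 2≤s s≤r ⟨
      suc (s ∸ 2 + (r ∸ (s ∸ 1))) ∎)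
      where open ≡-Reasoning

    -- b itself is the one vertex off the core that is not among the s ∸ 2 free ones.
    length-off : length off ≤ s ∸ 2
    length-off = ∸-monoˡ-≤ 2 (<-≤-trans (s≤s ∣off∣<offCore) offCore<s)
      where
      ∣off∣<offCore = ≤-<-trans (≤-reflexive (length-elements ((e - b) ∩ ∁ Core)))
                                (∣p-x∩q∣<∣p∩q∣ e (∁ Core) (x∈p∩q⁺ (b∈e , x∉p⇒x∈∁p b∉Core)))

    on⊆core : All (_∈ᴸ core) on
    on⊆core = All.tabulate λ x∈ → ∈-fromList⁻ core (proj₂ (x∈p∩q⁻ (e - b) Core (∈-elements⁻ x∈)))

    pieces = take-drop-∈-tuples (s ∸ 2) (r ∸ (s ∸ 1)) off on length-off length-rest
      (All.tabulate λ {x} _ → ∈-allFin x) on⊆core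

    listing≡e : fromList (b ∷ take (s ∸ 2) (off ++ on) ++ drop (s ∸ 2) (off ++ on)) ≡ e
    listing≡e = trans (cong (λ l → fromList (b ∷ l)) (take++drop≡id (s ∸ 2) (off ++ on)))
                      (fromList-≡ (∈-∷-splitList-remove e Core b∈e))

  ∈-candidates-block : ∀ {b e} → b ∉ A → e ∈ᴸ coreEdges ++ crossingEdges b → e ∈ᴸ candidates
  ∈-candidates-block b∉A e∈ =
    ∈-concatMap⁺ (λ b → coreEdges ++ crossingEdges b) (lose (∈-elements⁺ (x∉p⇒x∈∁p b∉A)) e∈)

  ∈-candidates : ∀ {e} → ∣ e ∣ ≡ r → ¬ e ⊆ A → offCore Core e < s → e ∈ᴸ candidates
  ∈-candidates {e} ∣e∣≡r e⊈A offCore<s with e ⊆? Core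
  ... | yes e⊆Core = ∈-candidates-block b₀∉A (∈-++⁺ˡ (∈-coreEdges ∣e∣≡r e⊆Core))
    where b₀∉A = proj₂ (proj₂ (⊈⇒∃ e⊈A))
  ... | no  e⊈Core with x , x∈e , x∉Core ← ⊈⇒∃ e⊈Core | Core⊆A⊎A⊆Core
  ...   | inj₁ Core⊆A = let b₀ , b₀∈e , b₀∉A = ⊈⇒∃ e⊈A in
          ∈-candidates-block b₀∉A (∈-++⁺ʳ coreEdges (∈-crossingEdges ∣e∣≡r b₀∈e (b₀∉A ∘ Core⊆A) offCore<s))
  ...   | inj₂ A⊆Core =
          ∈-candidates-block (x∉Core ∘ A⊆Core) (∈-++⁺ʳ coreEdges (∈-crossingEdges ∣e∣≡r x∈e x∉Core offCore<s))

  open DecMembership (_≟ˢ_ {n}) using () renaming (_∈?_ to _∈ᴸ?_)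
  open DecUnique (_≟ˢ_ {n}) using (deduplicate-!)

  G : RGraph n
  G e = ((∣ e ∣ ≡ r) × (e ⊆ A)) ⊎ (e ∈ₗ E')

  G? : ∀ e → Dec (G e)
  G? e = ((∣ e ∣ ≟ r) ×-dec (e ⊆? A)) ⊎-dec (e ∈ᴸ? E')

  Missing : Subset n → Set
  Missing e = (∣ e ∣ ≡ r) × ¬ G e

  Missing? : ∀ e → Dec (Missing e)
  Missing? e = (∣ e ∣ ≟ r) ×-dec ¬? (G? e)

  missing⇒s≤offCore : ∀ {e} → Missing e → s ≤ offCore Core e
  missing⇒s≤offCore {e} (∣e∣≡r , e∉G) with s ≤? offCore Core e
  ... | yes s≤offCore = s≤offCore
  ... | no  s≰offCore = ⊥-elim (e∉G (inj₂ (∈-filter⁺ (λ e → ∣ e ∣ ≟ r) e∈candidates ∣e∣≡r)))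
    where e∈candidates = ∈-candidates ∣e∣≡r (λ e⊆A → e∉G (inj₁ (∣e∣≡r , e⊆A))) (≰⇒> s≰offCore)

  allMissing : List (Subset n)
  allMissing = deduplicate _≟ˢ_ (filter Missing? (allSubsets n))

  ∈-allMissing : ∀ {e} → e ∈ᴸ allMissing ⇔ Missing e
  ∈-allMissing {e} = mk⇔
    (λ e∈ → proj₂ (∈-filter⁻ Missing? {xs = allSubsets n} (∈-deduplicate⁻ _≟ˢ_ (filter Missing? (allSubsets n)) e∈)))
    (λ e-missing → ∈-deduplicate⁺ _≟ˢ_ (∈-filter⁺ Missing? (∈-allSubsets e) e-missing))

  missingEdges : List (Subset n)
  missingEdges = levelsFrom (offCore Core) allMissing 0 (suc n)

  ∈-missingEdges : ∀ {e} → e ∈ᴸ missingEdges ⇔ Missing e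
  ∈-missingEdges {e} = mk⇔
    (λ e∈ → Equivalence.to ∈-allMissing (proj₁ (∈-levelsFrom⁻ (offCore Core) allMissing 0 (suc n) e∈)))
    (λ e-missing → ∈-levelsFrom⁺ (offCore Core) allMissing 0 (suc n) (Equivalence.from ∈-allMissing e-missing)
                     z≤n (s≤s (∣p∣≤n (e ∩ ∁ Core))))

  AddedUpTo : Fin (length missingEdges) → RGraph n
  AddedUpTo i e = G e ⊎ (e ∈ₗ take (suc (toℕ i)) missingEdges)

  missingEdge-copy : ∀ i → HasTemplateCopy r h s (AddedUpTo i) (lookup missingEdges i)
  missingEdge-copy i =
    template-copy s≤r r≤h ∣Core∣≡h ∣e∣≡r s≤offCore (inj₂ (lookup∈take missingEdges i (n<1+n _))) earlier
    where
    e = lookup missingEdges i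
    ∣e∣≡r = proj₁ (Equivalence.to ∈-missingEdges (∈-lookup i))
    s≤offCore = missing⇒s≤offCore (Equivalence.to ∈-missingEdges (∈-lookup i))

    ∣Core∣≡h : ∣ Core ∣ ≡ h
    ∣Core∣≡h with x , x∈e∖Core ← ∣p∣>0⇒nonempty (<-≤-trans (s≤s z≤n) (≤-trans 2≤s s≤offCore)) =
      ∉Core⇒∣Core∣≡h (x∈∁p⇒x∉p (proj₂ (x∈p∩q⁻ e (∁ Core) x∈e∖Core)))

    earlier : ∀ {e'} → ∣ e' ∣ ≡ r → offCore Core e' < offCore Core e → AddedUpTo i e'
    earlier {e'} ∣e'∣≡r smaller with G? e'
    ... | yes e'∈G = inj₁ e'∈G
    ... | no  e'∉G = inj₂ (AllPairs-∈-take-lookup (levelsFrom-sorted (offCore Core) allMissing 0 (suc n)) i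
                             (Equivalence.from ∈-missingEdges (∣e'∣≡r , e'∉G)) (<⇒≱ smaller))

  saturated : TemplateSaturated r h s G
  saturated = missingEdges , levelsFrom-unique (offCore Core) allMissing (deduplicate-! _) 0 (suc n)
            , (λ _ → ∈-missingEdges) , missingEdge-copy

  E'-edges : All (λ e → ∣ e ∣ ≡ r) E'
  E'-edges = Allₚ.all-filter (λ e → ∣ e ∣ ≟ r) candidates

  blockSize : ℕ
  blockSize = length core ^ r + n ^ (s ∸ 2) * length core ^ (r ∸ (s ∸ 1))

  length-block : ∀ b → length (coreEdges ++ crossingEdges b) ≡ blockSize
  length-block b = begin
    length (coreEdges ++ crossingEdges b)
      ≡⟨ length-++ coreEdges ⟩
    length coreEdges + length (crossingEdges b)
      ≡⟨ cong₂ _+_ (length-map fromList (tuples r core))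
                   (length-cartesianProductWith _ (tuples (s ∸ 2) (allFin n)) (tuples (r ∸ (s ∸ 1)) core)) ⟩
    length (tuples r core) + length (tuples (s ∸ 2) (allFin n)) * length (tuples (r ∸ (s ∸ 1)) core)
      ≡⟨ cong₂ _+_ (length-tuples r core) (cong₂ _*_ length-free (length-tuples (r ∸ (s ∸ 1)) core)) ⟩
    blockSize ∎
    where
    open ≡-Reasoning
    length-free = trans (length-tuples (s ∸ 2) (allFin n)) (cong (_^ (s ∸ 2)) (length-tabulate id))

  length-E' : ∣ ∁ A ∣ ≤ ∣ A ∣ → length E' ≤ r * h ^ r * ∣ A ∣ ^ (s ∸ 2) * ∣ ∁ A ∣
  length-E' ∣∁A∣≤∣A∣ = begin
    length E'                             ≤⟨ length-filter (λ e → ∣ e ∣ ≟ r) candidates ⟩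
    length candidates                     ≡⟨ length-concatMap-const _ length-block (elements (∁ A)) ⟩
    length (elements (∁ A)) * blockSize   ≡⟨ cong (_* blockSize) (length-elements (∁ A)) ⟩
    ∣ ∁ A ∣ * blockSize                   ≤⟨ edge-count-bound 2≤s s≤r r≤h ∣∁A∣≤∣A∣ length-core≤h n≤∣A∣+∣∁A∣ ⟩
    r * h ^ r * ∣ A ∣ ^ (s ∸ 2) * ∣ ∁ A ∣ ∎
    where
    open ≤-Reasoning
    n≤∣A∣+∣∁A∣ : n ≤ ∣ A ∣ + ∣ ∁ A ∣
    n≤∣A∣+∣∁A∣ = ≤-reflexive (sym (trans (cong (∣ A ∣ +_) (∣∁p∣≡n∸∣p∣ A)) (m+[n∸m]≡n (∣p∣≤n A))))

lemma2p4 : (h r s : ℕ) → 2 ≤ s → s ≤ r → r ≤ h →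
  (n : ℕ) (A : Subset n) → ∣ ∁ A ∣ ≤ ∣ A ∣ →
  Σ (List (Subset n)) λ E' →
    All (λ e → ∣ e ∣ ≡ r) E' ×
    length E' ≤ r * h ^ r * ∣ A ∣ ^ (s ∸ 2) * ∣ ∁ A ∣ ×
    TemplateSaturated r h s (λ e → ((∣ e ∣ ≡ r) × (e ⊆ A)) ⊎ (e ∈ₗ E'))
lemma2p4 h r s 2≤s s≤r r≤h n A ∣∁A∣≤∣A∣ = E' , E'-edges , length-E' ∣∁A∣≤∣A∣ , saturated
  where open Saturation 2≤s s≤r r≤h A
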